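{- Let $G$ be a graph and $H=\mathcal{I}(G)$. Suppose $H$ contains an induced $4$-cycle with vertices $X,A,B,Y$ (which are $i$-sets of $G$), where $XA,XB,AY,BY\in E(H)$ and $XY,AB\notin E(H)$. Then there exist distinct vertices $x_1,x_2,y_1,y_2$ of $G$ and a set $V\subseteq V(G)-\{x_1,x_2,y_1,y_2\}$ with $x_1y_1,x_2y_2\in E(G)$ such that $X=\{x_1,x_2\}\cup V$, $A=\{y_1,x_2\}\cup V$, $B=\{x_1,y_2\}\cup V$ and $Y=\{y_1,y_2\}\cup V$. In particular $A=(X-\{x_1\})\cup\{y_1\}$, $B=(X-\{x_2\})\cup\{y_2\}$, $Y=(A-\{x_2\})\cup\{y_2\}$ and $Y=(B-\{x_1\})\cup\{y_1\}$.
   Context: All graphs are finite and simple. For a graph $G$, $i(G)$ denotes the minimum cardinality of an independent dominating set of $G$; an independent dominating set of cardinality $i(G)$ is an $i$-set of $G$. The $i$-graph $\mathcal{I}(G)$ of $G$ is the graph whose vertices are the $i$-sets of $G$, where two $i$-sets $S$ and $S'$ are adjacent if and only if there is an edge $xy\in E(G)$ with $S'=(S-\{x\})\cup\{y\}$. -}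

module Defs where

open import Level using (0ℓ)
open import Data.Nat using (ℕ; _≤_)
open import Data.Fin using (Fin)
open import Data.Fin.Subset public using (Subset; _∈_; _∉_; _∪_; _-_; ⁅_⁆; ∣_∣)
open import Data.Product using (Σ; ∃; ∃-syntax; _×_; _,_)
open import Data.Sum using (_⊎_)
open import Relation.Nullary using (¬_)
open import Relation.Binary.PropositionalEquality using (_≡_)

record Graph : Set₁ where
  field
    n      : ℕ
    E      : Fin n → Fin n → Set
    sym    : ∀ {x y} → E x y → E y x
    irrefl : ∀ {x} → ¬ E x x
open Graph public

module _ (G : Graph) where
  V : Set
  V = Fin (n G)

  Independent : Subset (n G) → Set
  Independent S = ∀ x y → x ∈ S → y ∈ S → ¬ E G x y

  Dominating : Subset (n G) → Set
  Dominating S = ∀ v → v ∉ S → ∃[ u ] (u ∈ S × E G u v)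

  IndependentDominating : Subset (n G) → Set
  IndependentDominating S = Independent S × Dominating S

  IsISet : Subset (n G) → Set
  IsISet S = IndependentDominating S ×
             (∀ T → IndependentDominating T → ∣ S ∣ ≤ ∣ T ∣)

  -- adjacency in the i-graph: S' = (S - {x}) ∪ {y} for an edge xy
  -- (with x ∈ S, y ∉ S, so that this is a genuine token slide)
  IAdj : Subset (n G) → Subset (n G) → Set
  IAdj S S' = ∃[ x ] ∃[ y ] (E G x y × x ∈ S × y ∉ S × S' ≡ (S - x) ∪ ⁅ y ⁆)

{-# OPTIONS --safe #-}
-- Write the four slides as A = X[a↦a'], B = X[b↦b'], Y = A[c↦c'] = B[d↦d'].
-- If c = a', the same token moved twice and Y = X[a↦c']; as X dominates c' and
-- Y is independent, the neighbour of c' in X is a, so X = Y or X ~ Y.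
-- Otherwise c is a token of X. If c ≠ b, then c leaves B too, so c = d, while a'
-- survives in Y without lying in B, so a' = d': the edge dd' joins two tokens of A.
-- Hence c = b, and comparing the two descriptions of Y forces d = a, d' = a', c' = b'.
module Submission where

open import Defs hiding (sym)
open import Data.Nat using (ℕ)
open import Data.Fin using (Fin; suc; _≟_)
open import Data.Fin.Subset using (Subset; _∈_; _∉_; _∪_; _-_; ⁅_⁆)
open import Data.Fin.Subset.Properties
  using (⊆-antisym; ∪-comm; x∈⁅x⁆; x∈⁅y⁆⇒x≡y; x∈p∪q⁻; x∈p∪q⁺; x∈p∧x≢y⇒x∈p-y; p─q⊆p)
open import Data.Vec.Base using (_∷_; there)
open import Data.Product using (_×_; _,_; ∃-syntax)
open import Data.Sum using (_⊎_; inj₁; inj₂; [_,_]′)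
open import Data.Empty using (⊥; ⊥-elim)
open import Function using (_∘_)
open import Relation.Nullary using (¬_; yes; no)
open import Relation.Binary.PropositionalEquality
  using (_≡_; _≢_; refl; sym; trans; cong; subst; subst₂; module ≡-Reasoning)

x∉p-x : ∀ {m} (p : Subset m) {x : Fin m} → x ∉ p - x
x∉p-x (_ ∷ p) {suc x} (there x∈p-x) = x∉p-x p x∈p-x

module _ {m : ℕ} where

  infixl 5 _[_↦_]

  _[_↦_] : Subset m → Fin m → Fin m → Subset m
  P [ x ↦ y ] = (P - x) ∪ ⁅ y ⁆

  x∈p-y⇒x≢y : {p : Subset m} {x y : Fin m} → x ∈ p - y → x ≢ y
  x∈p-y⇒x≢y {p} x∈p-x refl = x∉p-x p x∈p-x

  x∈p-y⇒x∈p : {p : Subset m} {x y : Fin m} → x ∈ p - y → x ∈ p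
  x∈p-y⇒x∈p {p} {y = y} = p─q⊆p p ⁅ y ⁆

  module _ {P : Subset m} {x y : Fin m} where

    ∈[↦]⁻ : ∀ {z} → z ∈ P [ x ↦ y ] → (z ∈ P × z ≢ x) ⊎ z ≡ y
    ∈[↦]⁻ z∈ with x∈p∪q⁻ (P - x) ⁅ y ⁆ z∈
    ... | inj₁ z∈P-x = inj₁ (x∈p-y⇒x∈p z∈P-x , x∈p-y⇒x≢y z∈P-x)
    ... | inj₂ z∈⁅y⁆ = inj₂ (x∈⁅y⁆⇒x≡y y z∈⁅y⁆)

    ∈[↦]⁺ : ∀ {z} → z ∈ P → z ≢ x → z ∈ P [ x ↦ y ]
    ∈[↦]⁺ z∈P z≢x = x∈p∪q⁺ (inj₁ (x∈p∧x≢y⇒x∈p-y z∈P z≢x))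

    y∈[x↦y] : y ∈ P [ x ↦ y ]
    y∈[x↦y] = x∈p∪q⁺ {p = P - x} (inj₂ (x∈⁅x⁆ y))

    x∉[x↦y] : x ≢ y → x ∉ P [ x ↦ y ]
    x∉[x↦y] x≢y x∈ with ∈[↦]⁻ x∈
    ... | inj₁ (_ , x≢x) = x≢x refl
    ... | inj₂ x≡y = x≢y x≡y

    ∉[↦] : ∀ {z} → z ∉ P → z ≢ y → z ∉ P [ x ↦ y ]
    ∉[↦] z∉P z≢y z∈ with ∈[↦]⁻ z∈
    ... | inj₁ (z∈P , _) = z∉P z∈P
    ... | inj₂ z≡y = z≢y z≡y

    ∈[↦]-fresh : ∀ {z} → z ∈ P [ x ↦ y ] → z ∉ P → z ≡ y
    ∈[↦]-fresh z∈ z∉P with ∈[↦]⁻ z∈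
    ... | inj₁ (z∈P , _) = ⊥-elim (z∉P z∈P)
    ... | inj₂ z≡y = z≡y

    ∉[↦]-removed : ∀ {z} → z ∈ P → z ∉ P [ x ↦ y ] → z ≡ x
    ∉[↦]-removed {z} z∈P z∉ with z ≟ x
    ... | yes z≡x = z≡x
    ... | no z≢x = ⊥-elim (z∉ (∈[↦]⁺ z∈P z≢x))

  ∈⇒≢∉ : {P : Subset m} {z w : Fin m} → z ∈ P → w ∉ P → z ≢ w
  ∈⇒≢∉ z∈P w∉P refl = w∉P z∈P

  [↦]-trans : {P : Subset m} {x y z : Fin m} → y ∉ P → P [ x ↦ y ] [ y ↦ z ] ≡ P [ x ↦ z ]
  [↦]-trans {P} {x} {y} {z} y∉P = ⊆-antisym ⊆ ⊇
    where
    ⊆ : ∀ {w} → w ∈ P [ x ↦ y ] [ y ↦ z ] → w ∈ P [ x ↦ z ]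
    ⊆ w∈ with ∈[↦]⁻ w∈
    ... | inj₂ refl = y∈[x↦y]
    ... | inj₁ (w∈P[x↦y] , w≢y) with ∈[↦]⁻ w∈P[x↦y]
    ...   | inj₁ (w∈P , w≢x) = ∈[↦]⁺ w∈P w≢x
    ...   | inj₂ w≡y = ⊥-elim (w≢y w≡y)
    ⊇ : ∀ {w} → w ∈ P [ x ↦ z ] → w ∈ P [ x ↦ y ] [ y ↦ z ]
    ⊇ w∈ with ∈[↦]⁻ w∈
    ... | inj₂ refl = y∈[x↦y]
    ... | inj₁ (w∈P , w≢x) = ∈[↦]⁺ (∈[↦]⁺ w∈P w≢x) (∈⇒≢∉ w∈P y∉P)

  [↦]-refl : {P : Subset m} {x : Fin m} → x ∈ P → P [ x ↦ x ] ≡ P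
  [↦]-refl {P} {x} x∈P = ⊆-antisym ⊆ ⊇
    where
    ⊆ : ∀ {w} → w ∈ P [ x ↦ x ] → w ∈ P
    ⊆ w∈ with ∈[↦]⁻ w∈
    ... | inj₁ (w∈P , _) = w∈P
    ... | inj₂ refl = x∈P
    ⊇ : ∀ {w} → w ∈ P → w ∈ P [ x ↦ x ]
    ⊇ {w} w∈P with w ≟ x
    ... | yes refl = y∈[x↦y]
    ... | no w≢x = ∈[↦]⁺ w∈P w≢x

  module _ {p q : Fin m} {W : Subset m} where

    ∈pair∪⁻ : ∀ {z} → z ∈ (⁅ p ⁆ ∪ ⁅ q ⁆) ∪ W → z ≡ p ⊎ z ≡ q ⊎ z ∈ W
    ∈pair∪⁻ z∈ with x∈p∪q⁻ (⁅ p ⁆ ∪ ⁅ q ⁆) W z∈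
    ... | inj₂ z∈W = inj₂ (inj₂ z∈W)
    ... | inj₁ z∈pq with x∈p∪q⁻ ⁅ p ⁆ ⁅ q ⁆ z∈pq
    ...   | inj₁ z∈⁅p⁆ = inj₁ (x∈⁅y⁆⇒x≡y p z∈⁅p⁆)
    ...   | inj₂ z∈⁅q⁆ = inj₂ (inj₁ (x∈⁅y⁆⇒x≡y q z∈⁅q⁆))

    ∈pair∪⁺ : ∀ {z} → z ≡ p ⊎ z ≡ q ⊎ z ∈ W → z ∈ (⁅ p ⁆ ∪ ⁅ q ⁆) ∪ W
    ∈pair∪⁺ (inj₁ refl) = x∈p∪q⁺ (inj₁ (x∈p∪q⁺ (inj₁ (x∈⁅x⁆ p))))
    ∈pair∪⁺ (inj₂ (inj₁ refl)) = x∈p∪q⁺ (inj₁ (x∈p∪q⁺ {p = ⁅ p ⁆} (inj₂ (x∈⁅x⁆ q))))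
    ∈pair∪⁺ (inj₂ (inj₂ z∈W)) = x∈p∪q⁺ {p = ⁅ p ⁆ ∪ ⁅ q ⁆} (inj₂ z∈W)

  pair∪-[↦]ˡ : {p q y : Fin m} {W : Subset m} → p ≢ q → p ∉ W →
               ((⁅ p ⁆ ∪ ⁅ q ⁆) ∪ W) [ p ↦ y ] ≡ (⁅ y ⁆ ∪ ⁅ q ⁆) ∪ W
  pair∪-[↦]ˡ {p} {q} {y} {W} p≢q p∉W = ⊆-antisym ⊆ ⊇
    where
    ⊆ : ∀ {z} → z ∈ ((⁅ p ⁆ ∪ ⁅ q ⁆) ∪ W) [ p ↦ y ] → z ∈ (⁅ y ⁆ ∪ ⁅ q ⁆) ∪ W
    ⊆ z∈ with ∈[↦]⁻ z∈
    ... | inj₂ z≡y = ∈pair∪⁺ (inj₁ z≡y)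
    ... | inj₁ (z∈ , z≢p) with ∈pair∪⁻ z∈
    ...   | inj₁ z≡p = ⊥-elim (z≢p z≡p)
    ...   | inj₂ z∈qW = ∈pair∪⁺ (inj₂ z∈qW)
    ⊇ : ∀ {z} → z ∈ (⁅ y ⁆ ∪ ⁅ q ⁆) ∪ W → z ∈ ((⁅ p ⁆ ∪ ⁅ q ⁆) ∪ W) [ p ↦ y ]
    ⊇ z∈ with ∈pair∪⁻ z∈
    ... | inj₁ refl = y∈[x↦y]
    ... | inj₂ (inj₁ refl) = ∈[↦]⁺ (∈pair∪⁺ (inj₂ (inj₁ refl))) (p≢q ∘ sym)
    ... | inj₂ (inj₂ z∈W) = ∈[↦]⁺ (∈pair∪⁺ (inj₂ (inj₂ z∈W))) (∈⇒≢∉ z∈W p∉W)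

  pair∪-[↦]ʳ : {p q y : Fin m} {W : Subset m} → q ≢ p → q ∉ W →
               ((⁅ p ⁆ ∪ ⁅ q ⁆) ∪ W) [ q ↦ y ] ≡ (⁅ p ⁆ ∪ ⁅ y ⁆) ∪ W
  pair∪-[↦]ʳ {p} {q} {y} {W} q≢p q∉W = begin
    ((⁅ p ⁆ ∪ ⁅ q ⁆) ∪ W) [ q ↦ y ]  ≡⟨ cong (λ S → (S ∪ W) [ q ↦ y ]) (∪-comm ⁅ p ⁆ ⁅ q ⁆) ⟩
    ((⁅ q ⁆ ∪ ⁅ p ⁆) ∪ W) [ q ↦ y ]  ≡⟨ pair∪-[↦]ˡ q≢p q∉W ⟩
    (⁅ y ⁆ ∪ ⁅ p ⁆) ∪ W              ≡⟨ cong (_∪ W) (∪-comm ⁅ y ⁆ ⁅ p ⁆) ⟩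
    (⁅ p ⁆ ∪ ⁅ y ⁆) ∪ W              ∎
    where open ≡-Reasoning

  pair∪-split : {X : Subset m} {a b : Fin m} → a ∈ X → b ∈ X → X ≡ (⁅ a ⁆ ∪ ⁅ b ⁆) ∪ (X - a - b)
  pair∪-split {X} {a} {b} a∈X b∈X = ⊆-antisym ⊆ ⊇
    where
    ⊆ : ∀ {z} → z ∈ X → z ∈ (⁅ a ⁆ ∪ ⁅ b ⁆) ∪ (X - a - b)
    ⊆ {z} z∈X with z ≟ a | z ≟ b
    ... | yes z≡a | _       = ∈pair∪⁺ (inj₁ z≡a)
    ... | no _    | yes z≡b = ∈pair∪⁺ (inj₂ (inj₁ z≡b))
    ... | no z≢a  | no z≢b  = ∈pair∪⁺ (inj₂ (inj₂ (x∈p∧x≢y⇒x∈p-y (x∈p∧x≢y⇒x∈p-y z∈X z≢a) z≢b)))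
    ⊇ : ∀ {z} → z ∈ (⁅ a ⁆ ∪ ⁅ b ⁆) ∪ (X - a - b) → z ∈ X
    ⊇ z∈ with ∈pair∪⁻ z∈
    ... | inj₁ refl = a∈X
    ... | inj₂ (inj₁ refl) = b∈X
    ... | inj₂ (inj₂ z∈W) = x∈p-y⇒x∈p (x∈p-y⇒x∈p z∈W)

  square-labels : {X A B Y : Subset m} {a a' b b' c' d d' : Fin m} →
                  a ∈ X → b ∈ X → a' ∉ X → b' ∉ X → a ≢ b → a' ≢ b' → c' ≢ a →
                  A ≡ X [ a ↦ a' ] → B ≡ X [ b ↦ b' ] → Y ≡ A [ b ↦ c' ] → Y ≡ B [ d ↦ d' ] →
                  c' ≡ b' × d ≡ a × d' ≡ a'
  square-labels {X} {a = a} {a'} {b} {b'} {c'} {d} {d'}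
    a∈X b∈X a'∉X b'∉X a≢b a'≢b' c'≢a refl refl refl Y≡B[d↦d'] =
    c'≡b' , d≡a , d'≡a'
    where
    a∉Y : a ∉ X [ a ↦ a' ] [ b ↦ c' ]
    a∉Y = ∉[↦] (x∉[x↦y] (∈⇒≢∉ a∈X a'∉X)) (c'≢a ∘ sym)
    d≡a : d ≡ a
    d≡a = sym (∉[↦]-removed (∈[↦]⁺ a∈X a≢b) (a∉Y ∘ subst (a ∈_) (sym Y≡B[d↦d'])))
    d'≡a' : d' ≡ a'
    d'≡a' = sym (∈[↦]-fresh (subst (a' ∈_) Y≡B[d↦d'] (∈[↦]⁺ y∈[x↦y] (∈⇒≢∉ b∈X a'∉X ∘ sym)))
                            (∉[↦] a'∉X a'≢b'))
    b'≢d : b' ≢ d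
    b'≢d b'≡d = ∈⇒≢∉ a∈X b'∉X (trans (sym d≡a) (sym b'≡d))
    c'≡b' : c' ≡ b'
    c'≡b' = sym (∈[↦]-fresh (subst (b' ∈_) (sym Y≡B[d↦d']) (∈[↦]⁺ y∈[x↦y] b'≢d))
                            (∉[↦] b'∉X (a'≢b' ∘ sym)))

module _ (G : Graph) where

  [↦]-edge : {X : Subset (n G)} {a y : Fin (n G)} → Dominating G X → Independent G (X [ a ↦ y ]) →
             a ∈ X → y ∉ X → E G a y
  [↦]-edge {X} {a} {y} domX indX[a↦y] a∈X y∉X with domX y y∉X
  ... | u , u∈X , uy with u ≟ a
  ...   | yes refl = uy
  ...   | no u≢a = ⊥-elim (indX[a↦y] u y (∈[↦]⁺ u∈X u≢a) y∈[x↦y] uy)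

  reslide⇒≡⊎IAdj : {X A Y : Subset (n G)} {a a' c' : Fin (n G)} →
                   Dominating G X → Independent G Y → a ∈ X → a' ∉ X → c' ∉ A →
                   A ≡ X [ a ↦ a' ] → Y ≡ A [ a' ↦ c' ] → X ≡ Y ⊎ IAdj G X Y
  reslide⇒≡⊎IAdj {X} {a = a} {a'} {c'} domX indY a∈X a'∉X c'∉A refl refl with c' ≟ a
  ... | yes refl = inj₁ (sym (trans ([↦]-trans a'∉X) ([↦]-refl a∈X)))
  ... | no c'≢a =
    inj₂ (a , c' , [↦]-edge domX (subst (Independent G) Y≡X[a↦c'] indY) a∈X c'∉X , a∈X , c'∉X , Y≡X[a↦c'])
    where
    Y≡X[a↦c'] : X [ a ↦ a' ] [ a' ↦ c' ] ≡ X [ a ↦ c' ]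
    Y≡X[a↦c'] = [↦]-trans a'∉X
    c'∉X : c' ∉ X
    c'∉X c'∈X = c'∉A (∈[↦]⁺ c'∈X c'≢a)

  [↦]-targets-distinct : {X A B : Subset (n G)} {a a' b b' : Fin (n G)} →
                         Independent G A → A ≢ B → b ∈ X → E G b b' →
                         A ≡ X [ a ↦ a' ] → B ≡ X [ b ↦ b' ] → a' ≢ b'
  [↦]-targets-distinct {a = a} {b = b} indA A≢B b∈X bb' refl refl refl with b ≟ a
  ... | yes refl = A≢B refl
  ... | no b≢a = indA b _ (∈[↦]⁺ b∈X b≢a) y∈[x↦y] bb'

  third-token-impossible : {X A B Y : Subset (n G)} {a a' b b' c c' d d' : Fin (n G)} →
    Independent G A → a' ∉ X → c ∈ X → c ≢ a → c ≢ b → a' ≢ b' → c' ∉ A → E G d d' →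
    A ≡ X [ a ↦ a' ] → B ≡ X [ b ↦ b' ] → Y ≡ A [ c ↦ c' ] → Y ≡ B [ d ↦ d' ] → ⊥
  third-token-impossible {X} {a = a} {a'} {b} {b'} {c} {c'} {d} {d'}
    indA a'∉X c∈X c≢a c≢b a'≢b' c'∉A dd' refl refl refl Y≡B[d↦d'] =
    indA c a' c∈A y∈[x↦y] (subst₂ (E G) (sym c≡d) (sym a'≡d') dd')
    where
    c∈A : c ∈ X [ a ↦ a' ]
    c∈A = ∈[↦]⁺ c∈X c≢a
    c≡d : c ≡ d
    c≡d = ∉[↦]-removed (∈[↦]⁺ c∈X c≢b)
                       (x∉[x↦y] (∈⇒≢∉ c∈A c'∉A) ∘ subst (c ∈_) (sym Y≡B[d↦d']))
    a'≡d' : a' ≡ d'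
    a'≡d' = ∈[↦]-fresh (subst (a' ∈_) Y≡B[d↦d'] (∈[↦]⁺ y∈[x↦y] (∈⇒≢∉ c∈X a'∉X ∘ sym)))
                       (∉[↦] a'∉X a'≢b')

  SlideSquare : (X A B Y : Subset (n G)) → Set
  SlideSquare X A B Y = ∃[ x₁ ] ∃[ x₂ ] ∃[ y₁ ] ∃[ y₂ ] ∃[ W ]
    ( (x₁ ≢ x₂ × x₁ ≢ y₁ × x₁ ≢ y₂ × x₂ ≢ y₁ × x₂ ≢ y₂ × y₁ ≢ y₂)
    × (x₁ ∉ W × x₂ ∉ W × y₁ ∉ W × y₂ ∉ W)
    × E G x₁ y₁ × E G x₂ y₂
    × X ≡ (⁅ x₁ ⁆ ∪ ⁅ x₂ ⁆) ∪ W
    × A ≡ (⁅ y₁ ⁆ ∪ ⁅ x₂ ⁆) ∪ W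
    × B ≡ (⁅ x₁ ⁆ ∪ ⁅ y₂ ⁆) ∪ W
    × Y ≡ (⁅ y₁ ⁆ ∪ ⁅ y₂ ⁆) ∪ W
    × A ≡ X [ x₁ ↦ y₁ ]
    × B ≡ X [ x₂ ↦ y₂ ]
    × Y ≡ A [ x₂ ↦ y₂ ]
    × Y ≡ B [ x₁ ↦ y₁ ] )

  slide-square : {X A B Y : Subset (n G)} {a a' b b' : Fin (n G)} →
    a ∈ X → b ∈ X → a' ∉ X → b' ∉ X → a ≢ b → a' ≢ b' → E G a a' → E G b b' →
    A ≡ X [ a ↦ a' ] → B ≡ X [ b ↦ b' ] → Y ≡ A [ b ↦ b' ] → Y ≡ B [ a ↦ a' ] → SlideSquare X A B Y
  slide-square {X} {A} {B} {Y} {a} {a'} {b} {b'} a∈X b∈X a'∉X b'∉X a≢b a'≢b' aa' bb' A≡ B≡ Y≡A Y≡B =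
    a , b , a' , b' , W ,
    (a≢b , ∈⇒≢∉ a∈X a'∉X , ∈⇒≢∉ a∈X b'∉X , ∈⇒≢∉ b∈X a'∉X , ∈⇒≢∉ b∈X b'∉X , a'≢b') ,
    (a∉W , b∉W , a'∉W , b'∉W) , aa' , bb' ,
    X≡pair , A≡pair , B≡pair , Y≡pair , A≡ , B≡ , Y≡A , Y≡B
    where
    open ≡-Reasoning
    W : Subset (n G)
    W = X - a - b
    a∉W : a ∉ W
    a∉W = x∉p-x X ∘ x∈p-y⇒x∈p
    b∉W : b ∉ W
    b∉W = x∉p-x (X - a)
    a'∉W : a' ∉ W
    a'∉W = a'∉X ∘ x∈p-y⇒x∈p ∘ x∈p-y⇒x∈p
    b'∉W : b' ∉ W
    b'∉W = b'∉X ∘ x∈p-y⇒x∈p ∘ x∈p-y⇒x∈p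
    X≡pair : X ≡ (⁅ a ⁆ ∪ ⁅ b ⁆) ∪ W
    X≡pair = pair∪-split a∈X b∈X
    A≡pair : A ≡ (⁅ a' ⁆ ∪ ⁅ b ⁆) ∪ W
    A≡pair = begin
      A                               ≡⟨ A≡ ⟩
      X [ a ↦ a' ]                    ≡⟨ cong (λ S → S [ a ↦ a' ]) X≡pair ⟩
      ((⁅ a ⁆ ∪ ⁅ b ⁆) ∪ W) [ a ↦ a' ] ≡⟨ pair∪-[↦]ˡ a≢b a∉W ⟩
      (⁅ a' ⁆ ∪ ⁅ b ⁆) ∪ W            ∎
    B≡pair : B ≡ (⁅ a ⁆ ∪ ⁅ b' ⁆) ∪ W
    B≡pair = begin
      B                               ≡⟨ B≡ ⟩
      X [ b ↦ b' ]                    ≡⟨ cong (λ S → S [ b ↦ b' ]) X≡pair ⟩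
      ((⁅ a ⁆ ∪ ⁅ b ⁆) ∪ W) [ b ↦ b' ] ≡⟨ pair∪-[↦]ʳ (a≢b ∘ sym) b∉W ⟩
      (⁅ a ⁆ ∪ ⁅ b' ⁆) ∪ W            ∎
    Y≡pair : Y ≡ (⁅ a' ⁆ ∪ ⁅ b' ⁆) ∪ W
    Y≡pair = begin
      Y                                 ≡⟨ Y≡A ⟩
      A [ b ↦ b' ]                      ≡⟨ cong (λ S → S [ b ↦ b' ]) A≡pair ⟩
      ((⁅ a' ⁆ ∪ ⁅ b ⁆) ∪ W) [ b ↦ b' ] ≡⟨ pair∪-[↦]ʳ (∈⇒≢∉ b∈X a'∉X) b∉W ⟩
      (⁅ a' ⁆ ∪ ⁅ b' ⁆) ∪ W             ∎

proposition2p6 : (G : Graph) → (X A B Y : Subset (n G)) →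
    IsISet G X → IsISet G A → IsISet G B → IsISet G Y →
    X ≢ A → X ≢ B → X ≢ Y → A ≢ B → A ≢ Y → B ≢ Y →
    IAdj G X A → IAdj G X B → IAdj G A Y → IAdj G B Y →
    ¬ IAdj G X Y → ¬ IAdj G A B →
    ∃[ x₁ ] ∃[ x₂ ] ∃[ y₁ ] ∃[ y₂ ] ∃[ W ]
      ( (x₁ ≢ x₂ × x₁ ≢ y₁ × x₁ ≢ y₂ × x₂ ≢ y₁ × x₂ ≢ y₂ × y₁ ≢ y₂)
      × (x₁ ∉ W × x₂ ∉ W × y₁ ∉ W × y₂ ∉ W)
      × E G x₁ y₁ × E G x₂ y₂
      × X ≡ (⁅ x₁ ⁆ ∪ ⁅ x₂ ⁆) ∪ W
      × A ≡ (⁅ y₁ ⁆ ∪ ⁅ x₂ ⁆) ∪ W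
      × B ≡ (⁅ x₁ ⁆ ∪ ⁅ y₂ ⁆) ∪ W
      × Y ≡ (⁅ y₁ ⁆ ∪ ⁅ y₂ ⁆) ∪ W
      × A ≡ (X - x₁) ∪ ⁅ y₁ ⁆
      × B ≡ (X - x₂) ∪ ⁅ y₂ ⁆
      × Y ≡ (A - x₂) ∪ ⁅ y₂ ⁆
      × Y ≡ (B - x₁) ∪ ⁅ y₁ ⁆ )
proposition2p6 G X _ _ _ ((indX , domX) , _) ((indA , _) , _) _ ((indY , _) , _) _ _ X≢Y A≢B _ _
  (a , a' , aa' , a∈X , a'∉X , refl) (b , b' , bb' , b∈X , b'∉X , refl)
  (c , c' , cc' , c∈A , c'∉A , refl) (d , d' , dd' , _ , _ , Y≡B[d↦d']) ¬XY _
  with [↦]-targets-distinct G indA A≢B b∈X bb' refl refl | ∈[↦]⁻ c∈A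
... | _ | inj₂ refl =
  ⊥-elim ([ X≢Y , ¬XY ]′ (reslide⇒≡⊎IAdj G domX indY a∈X a'∉X c'∉A refl refl))
... | a'≢b' | inj₁ (c∈X , c≢a) with c ≟ b
...   | no c≢b =
  ⊥-elim (third-token-impossible G indA a'∉X c∈X c≢a c≢b a'≢b' c'∉A dd' refl refl refl Y≡B[d↦d'])
...   | yes refl
  with square-labels a∈X c∈X a'∉X b'∉X (c≢a ∘ sym) a'≢b' c'≢a refl refl refl Y≡B[d↦d']
  where
  c'≢a : c' ≢ a
  c'≢a refl = indX c c' c∈X a∈X cc'
...     | refl , refl , refl =
  slide-square G a∈X c∈X a'∉X b'∉X (c≢a ∘ sym) a'≢b' aa' bb' refl refl refl Y≡B[d↦d']
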